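{- Let $\mathcal H=(V,\mathcal E)$ be a hypergraph with $|V|\ge 2$ and $\bigcup\mathcal E=V$. If the automorphism group $\mathrm{Aut}(\mathcal H)$ is $2$-set transitive, then $f_{\mathcal H}$ is join-irreducible.
   Context: A hypergraph $\mathcal H=(V,\mathcal E)$ consists of a finite nonempty set $V=\{1,\dots,n\}$ and a collection $\mathcal E$ of subsets of $V$. $f_{\mathcal H}\colon\{0,1\}^n\to\{0,1\}$ is the function computed by the $GF(2)$ polynomial $\sum_{E\in\mathcal E}\prod_{i\in E}x_i$ (empty product $=1$). An automorphism of $\mathcal H$ is a bijection $\varphi\colon V\to V$ with $E\in\mathcal E\iff\varphi(E)\in\mathcal E$ for all $E\subseteq V$. A group $G$ acting on $V$ is $2$-set transitive if for any two 2-element subsets $e,e'$ of $V$ there is $g\in G$ with $g(e)=e'$. Simple minor order on Boolean functions: for $g$ of arity $m$, $f$ of arity $n$, $g\le f$ if there is $\sigma\colon\{1,\dots,n\}\to\{1,\dots,m\}$ with $g(a_1,\dots,a_m)=f(a_{\sigma(1)},\dots,a_{\sigma(n)})$ for all $a_i$; $g<f$ if $g\le f$ and $f\not\le g$. A Boolean function $f$ is join-irreducible if there is $f'<f$ such that every $g<f$ satisfies $g\le f'$. -}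

module Defs where

open import Data.Nat using (ℕ; zero; suc; _≤_)
open import Data.Bool using (Bool; true; false; _∧_; _∨_; not; _xor_)
open import Data.Fin using (Fin; zero; suc)
open import Data.Vec using (Vec; []; _∷_; lookup; tabulate)
open import Data.List using (List; []; _∷_; map; _++_; foldr)
open import Data.Product using (Σ; _×_; _,_; ∃)
open import Data.Sum using (_⊎_)
open import Data.Fin.Permutation using (Permutation′; _⟨$⟩ʳ_; _⟨$⟩ˡ_)
open import Relation.Binary.PropositionalEquality using (_≡_; _≢_)
open import Relation.Nullary using (¬_)

Subset : ℕ → Set
Subset n = Vec Bool n

record Hypergraph (n : ℕ) : Set where
  field
    edge : Subset n → Bool
open Hypergraph public

BoolFun : ℕ → Set
BoolFun n = (Fin n → Bool) → Bool

allSubsets : (n : ℕ) → List (Subset n)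
allSubsets zero = [] ∷ []
allSubsets (suc n) = map (false ∷_) (allSubsets n) ++ map (true ∷_) (allSubsets n)

monomial : ∀ {n} → Subset n → (Fin n → Bool) → Bool
monomial [] x = true
monomial (e ∷ E) x = (not e ∨ x zero) ∧ monomial E (λ i → x (suc i))

-- f_H(x) = Σ_{E ∈ 𝓔} ∏_{i∈E} x_i over GF(2).
fH : ∀ {n} → Hypergraph n → BoolFun n
fH {n} H x = foldr (λ E acc → (edge H E ∧ monomial E x) xor acc) false (allSubsets n)

-- Image φ(E) of a subset under a permutation φ: j ∈ φ(E) iff φ⁻¹(j) ∈ E.
image : ∀ {n} → Permutation′ n → Subset n → Subset n
image φ E = tabulate (λ j → lookup E (φ ⟨$⟩ˡ j))

IsAutomorphism : ∀ {n} → Hypergraph n → Permutation′ n → Set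
IsAutomorphism {n} H φ = (E : Subset n) → edge H E ≡ edge H (image φ E)

TwoSetTransitiveAut : ∀ {n} → Hypergraph n → Set
TwoSetTransitiveAut {n} H =
  (i j k l : Fin n) → i ≢ j → k ≢ l →
  Σ (Permutation′ n) λ φ → IsAutomorphism H φ ×
    (((φ ⟨$⟩ʳ i ≡ k) × (φ ⟨$⟩ʳ j ≡ l)) ⊎ ((φ ⟨$⟩ʳ i ≡ l) × (φ ⟨$⟩ʳ j ≡ k)))

CoversV : ∀ {n} → Hypergraph n → Set
CoversV {n} H = (i : Fin n) → Σ (Subset n) λ E → (edge H E ≡ true) × (lookup E i ≡ true)

_≼_ : ∀ {m n} → BoolFun m → BoolFun n → Set
_≼_ {m} {n} g f = Σ (Fin n → Fin m) λ σ → (a : Fin m → Bool) → g a ≡ f (λ i → a (σ i))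

_≺_ : ∀ {m n} → BoolFun m → BoolFun n → Set
g ≺ f = (g ≼ f) × ¬ (f ≼ g)

JoinIrreducible : ∀ {n} → BoolFun n → Set
JoinIrreducible f =
  Σ ℕ λ m → Σ (BoolFun m) λ f' → (f' ≺ f) ×
    ((k : ℕ) (g : BoolFun k) → g ≺ f → g ≼ f')

-- Over GF(2), Möbius inversion recovers the hypergraph from f_H: summing f_H over all subsets of E
-- gives [E ∈ 𝓔]. A variable k that f ignores kills every such sum with k ∈ E, so when ⋃𝓔 = V every
-- variable of f_H is essential, and f_H is not a minor of any function of fewer variables.
-- Take f' = f_H with x₀ and x₁ identified; then f' < f_H. A minor g < f_H is given by some
-- σ : V → [m]; σ is not injective (else f_H ≤ g), so it identifies some pair {i, j}, and an
-- automorphism carrying {0, 1} onto {i, j} leaves f_H invariant and exhibits g as a minor of f'.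

module Submission where

open import Defs
open import Data.Nat using (ℕ; zero; suc; _≤_; _<_; s≤s; z≤n)
open import Data.Nat.Properties using (<⇒≱; n<1+n)
open import Data.Bool using (Bool; true; false; _∧_; _∨_; not; _xor_; T)
open import Data.Bool.Properties as Bool
  using (xor-assoc; xor-same; ∧-comm; ∧-assoc; ∧-zeroʳ; ∧-identityʳ; ∨-zeroʳ; T-∧;
         ∧-distribˡ-xor; ∧-distribʳ-xor)
open import Data.Fin using (Fin; zero; suc; pinch)
open import Data.Fin.Properties using (_≟_; any?; all?; ¬∀⟶∃¬; injective⇒≤)
open import Data.Vec using ([]; _∷_; lookup; _[_]≔_)
open import Data.Vec.Properties
  using (lookup∘tabulate; tabulate∘lookup; tabulate-cong; lookup∘update′)
import Data.Vec.Properties as Vec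
open import Data.List using (List; []; _∷_; map; _++_; foldr)
open import Data.Product using (Σ; _×_; _,_; ∃; ∃₂; proj₁; proj₂)
open import Data.Sum using (_⊎_; inj₁; inj₂)
open import Data.Empty using (⊥-elim)
open import Data.Fin.Permutation using (Permutation′; _⟨$⟩ʳ_; _⟨$⟩ˡ_; inverseˡ; inverseʳ; flip)
open import Function using (_∘_; _⇔_; mk⇔; Equivalence)
open import Function.Definitions using (Injective)
open import Relation.Binary.PropositionalEquality
open import Relation.Binary.Definitions using (DecidableEquality)
open import Relation.Binary.Core using (_Preserves_⟶_)
open import Relation.Nullary using (¬_; yes; no; does)
open import Relation.Nullary.Decidable using (does-⇔; T?; ¬?; _×-dec_; decidable-stable)
open import Algebra using (CommutativeMonoid; CommutativeRing)
open import Algebra.Properties.CommutativeSemigroup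
  (CommutativeMonoid.commutativeSemigroup Bool.∧-commutativeMonoid)
  using () renaming (interchange to ∧-interchange)
open import Algebra.Properties.CommutativeSemigroup
  (CommutativeRing.+-commutativeSemigroup Bool.xor-∧-commutativeRing)
  using () renaming (interchange to xor-interchange)

private
  variable
    A B : Set
    m n : ℕ

xorSum : List A → (A → Bool) → Bool
xorSum L h = foldr (λ a acc → h a xor acc) false L

xorSum-cong : (L : List A) {h k : A → Bool} → h ≗ k → xorSum L h ≡ xorSum L k
xorSum-cong []      h≗k = refl
xorSum-cong (a ∷ L) h≗k = cong₂ _xor_ (h≗k a) (xorSum-cong L h≗k)

xorSum-zero : (L : List A) → xorSum L (λ _ → false) ≡ false
xorSum-zero []      = refl
xorSum-zero (a ∷ L) = xorSum-zero L

xorSum-xor : (L : List A) (h k : A → Bool) →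
             xorSum L (λ a → h a xor k a) ≡ xorSum L h xor xorSum L k
xorSum-xor []      h k = refl
xorSum-xor (a ∷ L) h k =
  trans (cong ((h a xor k a) xor_) (xorSum-xor L h k)) (xor-interchange (h a) (k a) _ _)

xorSum-∧ˡ : (L : List A) (b : Bool) (h : A → Bool) → xorSum L (λ a → b ∧ h a) ≡ b ∧ xorSum L h
xorSum-∧ˡ []      b h = sym (∧-zeroʳ b)
xorSum-∧ˡ (a ∷ L) b h =
  trans (cong ((b ∧ h a) xor_) (xorSum-∧ˡ L b h)) (sym (∧-distribˡ-xor b (h a) _))

xorSum-swap : (L : List A) (M : List B) (h : A → B → Bool) →
              xorSum L (λ a → xorSum M (h a)) ≡ xorSum M (λ b → xorSum L (λ a → h a b))
xorSum-swap []      M h = sym (xorSum-zero M)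
xorSum-swap (a ∷ L) M h =
  trans (cong (xorSum M (h a) xor_) (xorSum-swap L M h))
        (sym (xorSum-xor M (h a) (λ b → xorSum L (λ a → h a b))))

xorSum-++ : (L M : List A) (h : A → Bool) → xorSum (L ++ M) h ≡ xorSum L h xor xorSum M h
xorSum-++ []      M h = refl
xorSum-++ (a ∷ L) M h = trans (cong (h a xor_) (xorSum-++ L M h)) (sym (xor-assoc (h a) _ _))

xorSum-map : (f : A → B) (L : List A) (h : B → Bool) → xorSum (map f L) h ≡ xorSum L (h ∘ f)
xorSum-map f []      h = refl
xorSum-map f (a ∷ L) h = cong (h (f a) xor_) (xorSum-map f L h)

subsetSum : (n : ℕ) → (Subset n → Bool) → Bool
subsetSum n = xorSum (allSubsets n)

subsetSum-suc : (n : ℕ) (h : Subset (suc n) → Bool) →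
                subsetSum (suc n) h ≡ subsetSum n (h ∘ (false ∷_)) xor subsetSum n (h ∘ (true ∷_))
subsetSum-suc n h = trans (xorSum-++ (map (false ∷_) (allSubsets n)) _ h)
  (cong₂ _xor_ (xorSum-map (false ∷_) (allSubsets n) h) (xorSum-map (true ∷_) (allSubsets n) h))

infix 4 _≟ˢ_
_≟ˢ_ : DecidableEquality (Subset n)
_≟ˢ_ = Vec.≡-dec Bool._≟_

subsetSum-indicator : (G : Subset n) → subsetSum n (λ E → does (E ≟ˢ G)) ≡ true
subsetSum-indicator []                  = refl
subsetSum-indicator {suc n} (true ∷ G)  =
  trans (subsetSum-suc n (λ E → does (E ≟ˢ true ∷ G)))
        (cong₂ _xor_ (xorSum-zero (allSubsets n)) (subsetSum-indicator G))
subsetSum-indicator {suc n} (false ∷ G) =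
  trans (subsetSum-suc n (λ E → does (E ≟ˢ false ∷ G)))
        (cong₂ _xor_ (subsetSum-indicator G) (xorSum-zero (allSubsets n)))

subsetSum-select : (G : Subset n) (h : Subset n → Bool) →
                   subsetSum n (λ E → does (E ≟ˢ G) ∧ h E) ≡ h G
subsetSum-select {n} G h = begin
  subsetSum n (λ E → does (E ≟ˢ G) ∧ h E) ≡⟨ xorSum-cong (allSubsets n) only-G ⟩
  subsetSum n (λ E → h G ∧ does (E ≟ˢ G)) ≡⟨ xorSum-∧ˡ (allSubsets n) (h G) _ ⟩
  h G ∧ subsetSum n (λ E → does (E ≟ˢ G)) ≡⟨ cong (h G ∧_) (subsetSum-indicator G) ⟩
  h G ∧ true                              ≡⟨ ∧-identityʳ (h G) ⟩
  h G                                     ∎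
  where
  open ≡-Reasoning
  only-G : ∀ E → does (E ≟ˢ G) ∧ h E ≡ h G ∧ does (E ≟ˢ G)
  only-G E with E ≟ˢ G
  ... | yes refl = ∧-comm true (h E)
  ... | no _     = sym (∧-zeroʳ (h G))

subsetSum-reindex : (π π⁻¹ : Subset n → Subset n) →
                    (∀ E → π⁻¹ (π E) ≡ E) → (∀ F → π (π⁻¹ F) ≡ F) →
                    (h : Subset n → Bool) → subsetSum n (h ∘ π) ≡ subsetSum n h
subsetSum-reindex {n} π π⁻¹ left right h = begin
  subsetSum n (h ∘ π)
    ≡⟨ xorSum-cong (allSubsets n) (λ E → sym (subsetSum-select (π E) h)) ⟩
  subsetSum n (λ E → subsetSum n (λ F → does (F ≟ˢ π E) ∧ h F))
    ≡⟨ xorSum-swap (allSubsets n) (allSubsets n) (λ E F → does (F ≟ˢ π E) ∧ h F) ⟩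
  subsetSum n (λ F → subsetSum n (λ E → does (F ≟ˢ π E) ∧ h F))
    ≡⟨ xorSum-cong (allSubsets n) (λ F → xorSum-cong (allSubsets n) (λ E →
         cong (_∧ h F) (does-⇔ (transpose F E) (F ≟ˢ π E) (E ≟ˢ π⁻¹ F)))) ⟩
  subsetSum n (λ F → subsetSum n (λ E → does (E ≟ˢ π⁻¹ F) ∧ h F))
    ≡⟨ xorSum-cong (allSubsets n) (λ F → subsetSum-select (π⁻¹ F) (λ _ → h F)) ⟩
  subsetSum n h ∎
  where
  open ≡-Reasoning
  transpose : ∀ F E → (F ≡ π E) ⇔ (E ≡ π⁻¹ F)
  transpose F E = mk⇔ (λ p → trans (sym (left E)) (cong π⁻¹ (sym p)))
                      (λ q → trans (sym (right F)) (cong π (sym q)))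

insertInvariant⇒subsetSum≡false : (k : Fin n) (h : Subset n → Bool) →
                                  (∀ S → h (S [ k ]≔ true) ≡ h S) → subsetSum n h ≡ false
insertInvariant⇒subsetSum≡false {suc n} zero h invariant = begin
  subsetSum (suc n) h
    ≡⟨ subsetSum-suc n h ⟩
  subsetSum n (h ∘ (false ∷_)) xor subsetSum n (h ∘ (true ∷_))
    ≡⟨ cong (subsetSum n (h ∘ (false ∷_)) xor_)
            (xorSum-cong (allSubsets n) (invariant ∘ (false ∷_))) ⟩
  subsetSum n (h ∘ (false ∷_)) xor subsetSum n (h ∘ (false ∷_))
    ≡⟨ xor-same (subsetSum n (h ∘ (false ∷_))) ⟩
  false ∎
  where open ≡-Reasoning
insertInvariant⇒subsetSum≡false {suc n} (suc k) h invariant =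
  trans (subsetSum-suc n h)
        (cong₂ _xor_ (insertInvariant⇒subsetSum≡false k (h ∘ (false ∷_)) (invariant ∘ (false ∷_)))
                     (insertInvariant⇒subsetSum≡false k (h ∘ (true ∷_)) (invariant ∘ (true ∷_))))

infix 7 _⊆ᵇ_
_⊆ᵇ_ : Subset n → Subset n → Bool
F ⊆ᵇ S = monomial F (lookup S)

-- There are 2^|E ∖ F| sets between F and E when F ⊆ E, and none otherwise.
subsetSum-interval : (F E : Subset n) → subsetSum n (λ S → F ⊆ᵇ S ∧ S ⊆ᵇ E) ≡ does (F ≟ˢ E)
subsetSum-interval []      []      = refl
subsetSum-interval {suc n} (f ∷ F) (e ∷ E) = begin
  subsetSum (suc n) (λ S → (f ∷ F) ⊆ᵇ S ∧ S ⊆ᵇ (e ∷ E))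
    ≡⟨ subsetSum-suc n (λ S → (f ∷ F) ⊆ᵇ S ∧ S ⊆ᵇ (e ∷ E)) ⟩
  subsetSum n (interval false) xor subsetSum n (interval true)
    ≡⟨ cong₂ _xor_ (layer false) (layer true) ⟩
  (between false ∧ does (F ≟ˢ E)) xor (between true ∧ does (F ≟ˢ E))
    ≡⟨ sym (∧-distribʳ-xor (does (F ≟ˢ E)) (between false) (between true)) ⟩
  (between false xor between true) ∧ does (F ≟ˢ E)
    ≡⟨ cong (_∧ does (F ≟ˢ E)) (between-parity f e) ⟩
  does (f Bool.≟ e) ∧ does (F ≟ˢ E) ∎
  where
  open ≡-Reasoning
  interval : Bool → Subset n → Bool
  interval s S = (f ∷ F) ⊆ᵇ (s ∷ S) ∧ (s ∷ S) ⊆ᵇ (e ∷ E)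
  between : Bool → Bool
  between s = (not f ∨ s) ∧ (not s ∨ e)
  layer : ∀ s → subsetSum n (interval s) ≡ between s ∧ does (F ≟ˢ E)
  layer s = trans (xorSum-cong (allSubsets n)
                    (λ S → ∧-interchange (not f ∨ s) (F ⊆ᵇ S) (not s ∨ e) (S ⊆ᵇ E)))
           (trans (xorSum-∧ˡ (allSubsets n) (between s) (λ S → F ⊆ᵇ S ∧ S ⊆ᵇ E))
                  (cong (between s ∧_) (subsetSum-interval F E)))
  between-parity : ∀ f e → ((not f ∨ false) ∧ (not false ∨ e)) xor ((not f ∨ true) ∧ (not true ∨ e))
                           ≡ does (f Bool.≟ e)
  between-parity false false = refl
  between-parity false true  = refl
  between-parity true  false = refl
  between-parity true  true  = refl

anfCoefficient : BoolFun n → Subset n → Bool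
anfCoefficient {n} f E = subsetSum n (λ S → S ⊆ᵇ E ∧ f (lookup S))

anfCoefficient-fH : (H : Hypergraph n) (E : Subset n) → anfCoefficient (fH H) E ≡ edge H E
anfCoefficient-fH {n} H E = begin
  anfCoefficient (fH H) E
    ≡⟨ xorSum-cong (allSubsets n) (λ S → sym (xorSum-∧ˡ (allSubsets n) (S ⊆ᵇ E) (term S))) ⟩
  subsetSum n (λ S → subsetSum n (λ F → S ⊆ᵇ E ∧ term S F))
    ≡⟨ xorSum-swap (allSubsets n) (allSubsets n) (λ S F → S ⊆ᵇ E ∧ term S F) ⟩
  subsetSum n (λ F → subsetSum n (λ S → S ⊆ᵇ E ∧ term S F))
    ≡⟨ xorSum-cong (allSubsets n) (λ F → xorSum-cong (allSubsets n) (λ S →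
         trans (∧-comm (S ⊆ᵇ E) (term S F)) (∧-assoc (edge H F) (F ⊆ᵇ S) (S ⊆ᵇ E)))) ⟩
  subsetSum n (λ F → subsetSum n (λ S → edge H F ∧ (F ⊆ᵇ S ∧ S ⊆ᵇ E)))
    ≡⟨ xorSum-cong (allSubsets n) (λ F →
         trans (xorSum-∧ˡ (allSubsets n) (edge H F) (λ S → F ⊆ᵇ S ∧ S ⊆ᵇ E))
               (trans (cong (edge H F ∧_) (subsetSum-interval F E)) (∧-comm (edge H F) _))) ⟩
  subsetSum n (λ F → does (F ≟ˢ E) ∧ edge H F)
    ≡⟨ subsetSum-select E (edge H) ⟩
  edge H E ∎
  where
  open ≡-Reasoning
  term : Subset n → Subset n → Bool
  term S F = edge H F ∧ F ⊆ᵇ S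

IrrelevantAt : BoolFun n → Fin n → Set
IrrelevantAt f k = ∀ S → f (lookup (S [ k ]≔ true)) ≡ f (lookup S)

⊆ᵇ-insert : (S E : Subset n) (k : Fin n) → lookup E k ≡ true → (S [ k ]≔ true) ⊆ᵇ E ≡ S ⊆ᵇ E
⊆ᵇ-insert (s ∷ S) (true ∷ E) zero    refl = cong (_∧ S ⊆ᵇ E) (sym (∨-zeroʳ (not s)))
⊆ᵇ-insert (s ∷ S) (e ∷ E)    (suc k) k∈E  = cong ((not s ∨ e) ∧_) (⊆ᵇ-insert S E k k∈E)

irrelevant⇒anfCoefficient≡false : (f : BoolFun n) (k : Fin n) → IrrelevantAt f k →
                                  (E : Subset n) → lookup E k ≡ true → anfCoefficient f E ≡ false
irrelevant⇒anfCoefficient≡false f k irrelevant E k∈E =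
  insertInvariant⇒subsetSum≡false k (λ S → S ⊆ᵇ E ∧ f (lookup S))
    (λ S → cong₂ _∧_ (⊆ᵇ-insert S E k k∈E) (irrelevant S))

fH-relevant : (H : Hypergraph n) → CoversV H → (k : Fin n) → ¬ IrrelevantAt (fH H) k
fH-relevant H covers k irrelevant with covers k
... | E , E∈H , k∈E
  with () ← trans (sym (irrelevant⇒anfCoefficient≡false (fH H) k irrelevant E k∈E))
                  (trans (anfCoefficient-fH H E) E∈H)

monomial-cong : (E : Subset n) → monomial E Preserves _≗_ ⟶ _≡_
monomial-cong []      x≗y = refl
monomial-cong (e ∷ E) x≗y =
  cong₂ (λ a b → (not e ∨ a) ∧ b) (x≗y zero) (monomial-cong E (x≗y ∘ suc))

fH-cong : (H : Hypergraph n) → fH H Preserves _≗_ ⟶ _≡_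
fH-cong {n} H x≗y = xorSum-cong (allSubsets n) (λ E → cong (edge H E ∧_) (monomial-cong E x≗y))

T-monomial : (E : Subset n) (x : Fin n → Bool) →
             T (monomial E x) ⇔ (∀ i → T (lookup E i) → T (x i))
T-monomial E x = mk⇔ (to E x) (from E x)
  where
  to : ∀ {n} (E : Subset n) x → T (monomial E x) → ∀ i → T (lookup E i) → T (x i)
  to (true ∷ E)  x t zero    _ = proj₁ (Equivalence.to T-∧ t)
  to (true ∷ E)  x t (suc i)   = to E (x ∘ suc) (proj₂ (Equivalence.to (T-∧ {x zero}) t)) i
  to (false ∷ E) x t (suc i)   = to E (x ∘ suc) t i
  from : ∀ {n} (E : Subset n) x → (∀ i → T (lookup E i) → T (x i)) → T (monomial E x)
  from []          x h = _
  from (true ∷ E)  x h = Equivalence.from T-∧ (h zero _ , from E (x ∘ suc) (h ∘ suc))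
  from (false ∷ E) x h = from E (x ∘ suc) (h ∘ suc)

Invariant : BoolFun n → Permutation′ n → Set
Invariant f φ = ∀ x → f (λ i → x (φ ⟨$⟩ʳ i)) ≡ f x

monomial-image : (φ : Permutation′ n) (E : Subset n) (x : Fin n → Bool) →
                 monomial (image φ E) x ≡ monomial E (λ i → x (φ ⟨$⟩ʳ i))
monomial-image φ E x = does-⇔ (mk⇔ (fromₑ ∘ forward ∘ toᵢ) (fromᵢ ∘ backward ∘ toₑ)) (T? _) (T? _)
  where
  open Equivalence (T-monomial (image φ E) x) using () renaming (to to toᵢ; from to fromᵢ)
  open Equivalence (T-monomial E (λ i → x (φ ⟨$⟩ʳ i))) using () renaming (to to toₑ; from to fromₑ)
  lookup-image : ∀ j → lookup (image φ E) j ≡ lookup E (φ ⟨$⟩ˡ j)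
  lookup-image = lookup∘tabulate (λ j → lookup E (φ ⟨$⟩ˡ j))
  lookup-image-φ : ∀ i → lookup (image φ E) (φ ⟨$⟩ʳ i) ≡ lookup E i
  lookup-image-φ i = trans (lookup-image (φ ⟨$⟩ʳ i)) (cong (lookup E) (inverseˡ φ))
  forward : (∀ j → T (lookup (image φ E) j) → T (x j)) →
            ∀ i → T (lookup E i) → T (x (φ ⟨$⟩ʳ i))
  forward h i t = h (φ ⟨$⟩ʳ i) (subst T (sym (lookup-image-φ i)) t)
  backward : (∀ i → T (lookup E i) → T (x (φ ⟨$⟩ʳ i))) →
             ∀ j → T (lookup (image φ E) j) → T (x j)
  backward h j t = subst (T ∘ x) (inverseʳ φ) (h (φ ⟨$⟩ˡ j) (subst T (lookup-image j) t))

image-flip : (φ : Permutation′ n) (E : Subset n) → image (flip φ) (image φ E) ≡ E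
image-flip φ E = trans
  (tabulate-cong (λ i → trans (lookup∘tabulate _ (φ ⟨$⟩ʳ i)) (cong (lookup E) (inverseˡ φ))))
  (tabulate∘lookup E)

fH-invariant : (H : Hypergraph n) (φ : Permutation′ n) → IsAutomorphism H φ → Invariant (fH H) φ
fH-invariant {n} H φ automorphism x = begin
  fH H (λ i → x (φ ⟨$⟩ʳ i))
    ≡⟨ xorSum-cong (allSubsets n) (λ E → cong₂ _∧_ (automorphism E) (sym (monomial-image φ E x))) ⟩
  subsetSum n (λ E → edge H (image φ E) ∧ monomial (image φ E) x)
    ≡⟨ subsetSum-reindex (image φ) (image (flip φ)) (image-flip φ) (image-flip (flip φ))
                         (λ E → edge H E ∧ monomial E x) ⟩
  fH H x ∎
  where open ≡-Reasoning

<⇒missesPoint : m < n → (σ : Fin m → Fin n) → ∃ λ k → ∀ i → σ i ≢ k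
<⇒missesPoint {m} m<n σ with any? (λ k → all? (λ i → ¬? (σ i ≟ k)))
... | yes missed  = missed
... | no surjective = ⊥-elim (<⇒≱ m<n (injective⇒≤ section-injective))
  where
  preimage : ∀ k → ∃ λ i → σ i ≡ k
  preimage k with ¬∀⟶∃¬ m (λ i → σ i ≢ k) (λ i → ¬? (σ i ≟ k)) (λ miss → surjective (k , miss))
  ... | i , ¬σi≢k = i , decidable-stable (σ i ≟ k) ¬σi≢k
  section-injective : Injective _≡_ _≡_ (proj₁ ∘ preimage)
  section-injective {k} {l} eq =
    trans (sym (proj₂ (preimage k))) (trans (cong σ eq) (proj₂ (preimage l)))

injective⊎collision : (σ : Fin n → Fin m) → Injective _≡_ _≡_ σ ⊎ ∃₂ λ i j → i ≢ j × σ i ≡ σ j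
injective⊎collision σ with any? (λ i → any? (λ j → ¬? (i ≟ j) ×-dec σ i ≟ σ j))
... | yes (i , j , collision) = inj₂ (i , j , collision)
... | no none =
  inj₁ (λ {i} {j} σi≡σj → decidable-stable (i ≟ j) (λ i≢j → none (i , j , i≢j , σi≡σj)))

injective⇒retraction : (σ : Fin n → Fin m) → Injective _≡_ _≡_ σ → Fin n →
                       ∃ λ (τ : Fin m → Fin n) → ∀ i → τ (σ i) ≡ i
injective⇒retraction {n = n} {m = m} σ injective default = τ , τ∘σ
  where
  τ : Fin m → Fin n
  τ y with any? (λ i → σ i ≟ y)
  ... | yes (i , _) = i
  ... | no _        = default
  τ∘σ : ∀ i → τ (σ i) ≡ i
  τ∘σ i with any? (λ i′ → σ i′ ≟ σ i)
  ... | yes (i′ , σi′≡σi) = injective σi′≡σi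
  ... | no miss           = ⊥-elim (miss (i , refl))

≼-fewer⇒irrelevant : {f : BoolFun n} {g : BoolFun m} → g Preserves _≗_ ⟶ _≡_ →
                     m < n → f ≼ g → ∃ (IrrelevantAt f)
≼-fewer⇒irrelevant {g = g} g-cong m<n (σ , f≡g∘σ) with <⇒missesPoint m<n σ
... | k , missed = k , λ S →
  trans (f≡g∘σ _) (trans (g-cong (λ i → lookup∘update′ (missed i) S true)) (sym (f≡g∘σ _)))

≼-injective⇒≽ : {f : BoolFun n} {g : BoolFun m} → f Preserves _≗_ ⟶ _≡_ → Fin n →
                ((σ , _) : g ≼ f) → Injective _≡_ _≡_ σ → f ≼ g
≼-injective⇒≽ {f = f} {g} f-cong default (σ , g≡f∘σ) injective
  with τ , τ∘σ ← injective⇒retraction σ injective default =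
  τ , λ b → trans (f-cong (λ i → cong b (sym (τ∘σ i)))) (sym (g≡f∘σ (b ∘ τ)))

identify₀₁ : BoolFun (suc (suc n)) → BoolFun (suc n)
identify₀₁ f b = f (b ∘ pinch zero)

identify₀₁-cong : {f : BoolFun (suc (suc n))} → f Preserves _≗_ ⟶ _≡_ →
                  identify₀₁ f Preserves _≗_ ⟶ _≡_
identify₀₁-cong f-cong x≗y = f-cong (x≗y ∘ pinch zero)

identify₀₁-≼ : (f : BoolFun (suc (suc n))) → identify₀₁ f ≼ f
identify₀₁-≼ f = pinch zero , λ _ → refl

≼-collapsing⇒≼identify₀₁ : {f : BoolFun (suc (suc n))} {g : BoolFun m} → f Preserves _≗_ ⟶ _≡_ →
                            (ψ : Permutation′ (suc (suc n))) → Invariant f ψ →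
                            ((σ , _) : g ≼ f) → σ (ψ ⟨$⟩ʳ zero) ≡ σ (ψ ⟨$⟩ʳ suc zero) →
                            g ≼ identify₀₁ f
≼-collapsing⇒≼identify₀₁ {n = n} {m = m} f-cong ψ invariant (σ , g≡f∘σ) collide =
  σ′ , λ a → trans (g≡f∘σ a) (trans (sym (invariant (a ∘ σ))) (f-cong (pointwise a)))
  where
  σ′ : Fin (suc n) → Fin m
  σ′ t = σ (ψ ⟨$⟩ʳ suc t)
  pointwise : ∀ a i → a (σ (ψ ⟨$⟩ʳ i)) ≡ a (σ′ (pinch zero i))
  pointwise a zero    = cong a collide
  pointwise a (suc i) = refl

TwoSetTransitiveInvariance : BoolFun n → Set
TwoSetTransitiveInvariance {n} f =
  (i j k l : Fin n) → i ≢ j → k ≢ l →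
  Σ (Permutation′ n) λ φ → Invariant f φ ×
    (((φ ⟨$⟩ʳ i ≡ k) × (φ ⟨$⟩ʳ j ≡ l)) ⊎ ((φ ⟨$⟩ʳ i ≡ l) × (φ ⟨$⟩ʳ j ≡ k)))

joinIrreducible-twoSetTransitive : (f : BoolFun (suc (suc n))) → f Preserves _≗_ ⟶ _≡_ →
                                   (∀ k → ¬ IrrelevantAt f k) → TwoSetTransitiveInvariance f →
                                   JoinIrreducible f
joinIrreducible-twoSetTransitive {n} f f-cong relevant transitive =
  suc n , identify₀₁ f , (identify₀₁-≼ f , f⋠identify₀₁) , maximal
  where
  f⋠identify₀₁ : ¬ (f ≼ identify₀₁ f)
  f⋠identify₀₁ f≼
    with k , irrelevant ← ≼-fewer⇒irrelevant (identify₀₁-cong f-cong) (n<1+n (suc n)) f≼ =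
    relevant k irrelevant
  maximal : (m : ℕ) (g : BoolFun m) → g ≺ f → g ≼ identify₀₁ f
  maximal m g (g≼f@(σ , _) , f⋠g) with injective⊎collision σ
  ... | inj₁ injective = ⊥-elim (f⋠g (≼-injective⇒≽ f-cong zero g≼f injective))
  ... | inj₂ (i , j , i≢j , σi≡σj)
    with ψ , invariant , sends ← transitive zero (suc zero) i j (λ ()) i≢j =
    ≼-collapsing⇒≼identify₀₁ f-cong ψ invariant g≼f (collide sends)
    where
    collide : ((ψ ⟨$⟩ʳ zero ≡ i) × (ψ ⟨$⟩ʳ suc zero ≡ j)) ⊎
              ((ψ ⟨$⟩ʳ zero ≡ j) × (ψ ⟨$⟩ʳ suc zero ≡ i)) →
              σ (ψ ⟨$⟩ʳ zero) ≡ σ (ψ ⟨$⟩ʳ suc zero)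
    collide (inj₁ (ψ0≡i , ψ1≡j)) = trans (cong σ ψ0≡i) (trans σi≡σj (sym (cong σ ψ1≡j)))
    collide (inj₂ (ψ0≡j , ψ1≡i)) = trans (cong σ ψ0≡j) (trans (sym σi≡σj) (sym (cong σ ψ1≡i)))

corollary3p8 : (n : ℕ) (H : Hypergraph n) → 2 ≤ n → CoversV H →
    TwoSetTransitiveAut H → JoinIrreducible (fH H)
corollary3p8 (suc (suc n)) H (s≤s (s≤s z≤n)) covers transitive =
  joinIrreducible-twoSetTransitive (fH H) (fH-cong H) (fH-relevant H covers) invariance
  where
  invariance : TwoSetTransitiveInvariance (fH H)
  invariance i j k l i≢j k≢l with φ , automorphism , sends ← transitive i j k l i≢j k≢l =
    φ , fH-invariant H φ automorphism , sends
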